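{- Let $G=(S,A,\downarrow,\to)$ be a labeled transition system and $B\subseteq A$. Let $(\mathcal P_1,\sqsubseteq_1)$ and $(\mathcal P_2,\sqsubseteq_2)$ be partition-relation pairs over $G$ with $(\mathcal P_1,\sqsubseteq_1)\lhd(\mathcal P_2,\sqsubseteq_2)$. Let $\mathcal P'$ be a parent partition of $\mathcal P_2$ and let $S'$ be a splitter of $\mathcal P'$ with respect to $\mathcal P_2$. Then $\sigma(\mathcal P_1,\sqsubseteq_1,\mathcal P',S')\lhd\sigma(\mathcal P_2,\sqsubseteq_2,\mathcal P',S')$.
   Context: A labeled transition system $G=(S,A,\downarrow,\to)$ has state set $S$, action set $A$, termination predicate $\downarrow\subseteq S$ and transition relation $\to\subseteq S\times A\times S$ (write $p\xrightarrow{a}q$). A partition-relation pair is $(\mathcal P,\sqsubseteq)$ with $\mathcal P$ a partition of $S$ and $\sqsubseteq$ a partial order on $\mathcal P$. $(\mathcal P,\sqsubseteq)\lhd(\mathcal P',\sqsubseteq')$ iff for all $P\sqsubseteq Q$ in $\mathcal P$ there are $P',Q'\in\mathcal P'$ with $P\subseteq P'$, $Q\subseteq Q'$, $P'\sqsubseteq'Q'$. For a set $P'$ of states write $P'\downarrow$ if all its states terminate, $P'\not\downarrow$ if none does. For $P,X\subseteq S$: $P\xrightarrow{a}_\exists X$ means some $p\in P$ has $p\xrightarrow{a}x$, $x\in X$; $P\xrightarrow{a}_\forall X$ means every $p\in P$ has some $x\in X$ with $p\xrightarrow{a}x$. For a partition $\mathcal Q$ with partial order $\le$ and $Q\in\mathcal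 Q$, $\mathrm{lb}_\le(Q)=\bigcup\{R\in\mathcal Q\mid R\le Q\}$, $\mathrm{bb}_\le(Q)=\bigcup\{R\in\mathcal Q\mid Q\le R\}$. A partition $\mathcal P'$ of $S$ is a parent partition of $\mathcal P$ if every $P\in\mathcal P$ is contained in some $P'\in\mathcal P'$; $\sqsubseteq$ induces $\sqsubseteq'$ on $\mathcal P'$: $P'\sqsubseteq'Q'$ iff there are $P,Q\in\mathcal P$ with $P\subseteq P'$, $Q\subseteq Q'$, $P\sqsubseteq Q$. For $P'\in\mathcal P'$, $S'\subseteq P'$ and $T'=P'\setminus S'$, $S'$ is a splitter of $\mathcal P'$ w.r.t. $\mathcal P$ if every $P\in\mathcal P$ with $P\subseteq P'$ satisfies $P\subseteq S'$ or $P\cap S'=\emptyset$, and (for the relation induced by $\sqsubseteq$ on $S',T'$) either $S'\sqsubseteq'T'$ or $S'$ and $T'$ are unrelated; the splitter partition is $\mathcal P'\setminus\{P'\}\cup\{S',T'\}$. A pair $(\mathcal P,\sqsubseteq)$ with parent partition $\mathcal P'$ (with induced $\sqsubseteq'$), where every $P'\in\mathcal P'$ has $P'\downarrow$ or $P'\not\downarrow$, is stable w.r.t. $\mathcal P'$ and $B$ if: (1) for all $P\in\mathcal P$, $a\in A$, $R'\in\mathcal P'$: $P\xrightarrow{a}_\exists R'$ implies $P\xrightarrow{a}_\forall\mathrm{bb}_{\sqsubseteq'}(R')$; (2) for all $P\in\mathcal P$, $b\in B$, $R'\in\mathcal P'$: $P\xrightarrow{b}_\exists R'$ implies $P\xrightarrow{b}_\forall\mathrm{lb}_{\sqsubseteq'}(R')$;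 (3) for all $P,Q\in\mathcal P$, $a\in A$, $R'\in\mathcal P'$: $P\sqsubseteq Q$ and $P\xrightarrow{a}_\forall R'$ imply $Q\xrightarrow{a}_\forall\mathrm{bb}_{\sqsubseteq'}(R')$; (4) for all $P,Q\in\mathcal P$, $b\in B$, $R'\in\mathcal P'$: $P\sqsubseteq Q$ and $Q\xrightarrow{b}_\forall R'$ imply $P\xrightarrow{b}_\forall\mathrm{lb}_{\sqsubseteq'}(R')$. The refinement operator (for $B$) is $\sigma(\mathcal P,\sqsubseteq,\mathcal P',S')=(\mathcal P_r,\sqsubseteq_r)$, the $\lhd$-coarsest partition-relation pair with $(\mathcal P_r,\sqsubseteq_r)\lhd(\mathcal P,\sqsubseteq)$ that is stable, in the sense of conditions (1)–(4), with respect to the splitter partition $\mathcal P'\setminus\{P'\}\cup\{S',T'\}$. -}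

module Defs where

open import Level using (0ℓ)
open import Data.Product using (Σ; ∃; ∃-syntax; _×_; _,_)
open import Data.Sum using (_⊎_)
open import Relation.Nullary using (¬_)
open import Relation.Binary using (Rel; IsEquivalence)

record LTS : Set₁ where
  field
    State  : Set
    Action : Set
    _↓     : State → Set
    _⟶[_]_ : State → Action → State → Set

module LTSDefs (G : LTS) where
  open LTS G

  -- A partition of S, represented by its equivalence relation (blocks = classes).
  record Partition : Set₁ where
    field
      _~_           : Rel State 0ℓ
      isEquivalence : IsEquivalence _~_

  -- A partition-relation pair (𝒫, ⊑): a partition of S together with a partial
  -- order on its blocks, represented as a relation on states that respects the
  -- partition (p ⊑ q means [p] ⊑ [q]).
  record PRPair : Set₁ where
    field
      _~_           : Rel State 0ℓ
      isEquivalence : IsEquivalence _~_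
      _⊑_           : Rel State 0ℓ
      ⊑-resp        : ∀ {p p' q q'} → p ~ p' → q ~ q' → p ⊑ q → p' ⊑ q'
      ⊑-refl        : ∀ {p} → p ⊑ p
      ⊑-trans       : ∀ {p q r} → p ⊑ q → q ⊑ r → p ⊑ r
      ⊑-antisym     : ∀ {p q} → p ⊑ q → q ⊑ p → p ~ q

  BlockIn : Rel State 0ℓ → State → Rel State 0ℓ → State → Set
  BlockIn _~_ p _~'_ p' = ∀ x → x ~ p → x ~' p'

  BlockSub : Rel State 0ℓ → State → (State → Set) → Set
  BlockSub _~_ p X = ∀ x → x ~ p → X x

  _⊲_ : PRPair → PRPair → Set
  P ⊲ P' = ∀ p q → p ⊑ q →
    ∃[ p' ] ∃[ q' ] (BlockIn _~_ p _~'_ p' × BlockIn _~_ q _~'_ q' × p' ⊑' q')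
    where
      open PRPair P
      open PRPair P' renaming (_~_ to _~'_; _⊑_ to _⊑'_) using ()

  IsParent : Rel State 0ℓ → Rel State 0ℓ → Set
  IsParent _~'_ _~_ = ∀ p → ∃[ p' ] BlockIn _~_ p _~'_ p'

  InducedSets : Rel State 0ℓ → Rel State 0ℓ → (State → Set) → (State → Set) → Set
  InducedSets _~_ _⊑_ X Y = ∃[ p ] ∃[ q ] (BlockSub _~_ p X × BlockSub _~_ q Y × p ⊑ q)

  Induced : PRPair → Rel State 0ℓ → Rel State 0ℓ
  Induced P _≈_ x y = InducedSets (PRPair._~_ P) (PRPair._⊑_ P) (λ z → z ≈ x) (λ z → z ≈ y)

  -- T' = P' ∖ S', where P' is the block of s₀ in the partition _~'_
  Compl : Rel State 0ℓ → State → (State → Set) → State → Set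
  Compl _~'_ s₀ S' x = (x ~' s₀) × ¬ S' x

  IsSplitter : PRPair → Partition → State → (State → Set) → Set
  IsSplitter P P' s₀ S' =
      (∀ x → S' x → x ~' s₀)
    × (∀ p → p ~' s₀ → BlockSub _~_ p S' ⊎ BlockSub _~_ p (λ x → ¬ S' x))
    × ((InducedSets _~_ _⊑_ S' T' × ¬ InducedSets _~_ _⊑_ T' S')
       ⊎ (¬ InducedSets _~_ _⊑_ S' T' × ¬ InducedSets _~_ _⊑_ T' S'))
    where
      open PRPair P
      open Partition P' renaming (_~_ to _~'_) using ()
      T' : State → Set
      T' = Compl _~'_ s₀ S'

  -- the splitter partition 𝒫' ∖ {P'} ∪ {S', T'} (as an equivalence relation)
  SplitRel : Partition → (State → Set) → Rel State 0ℓ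
  SplitRel P' S' x y = (x ~' y) × (S' x → S' y) × (S' y → S' x)
    where open Partition P' renaming (_~_ to _~'_) using ()

  Stable : (Action → Set) → PRPair → Rel State 0ℓ → Set
  Stable B P _≈_ =
      IsParent _≈_ _~_
    × (∀ x → (∀ y → y ≈ x → y ↓) ⊎ (∀ y → y ≈ x → ¬ (y ↓)))
    × (∀ p₀ a r → Ex p₀ a r → All p₀ a (λ x → r ⊑' x))
    × (∀ p₀ b r → B b → Ex p₀ b r → All p₀ b (λ x → x ⊑' r))
    × (∀ p₀ q₀ a r → p₀ ⊑ q₀ → All p₀ a (λ x → x ≈ r) → All q₀ a (λ x → r ⊑' x))
    × (∀ p₀ q₀ b r → B b → p₀ ⊑ q₀ → All q₀ b (λ x → x ≈ r) → All p₀ b (λ x → x ⊑' r))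
    where
      open PRPair P
      _⊑'_ : Rel State 0ℓ
      _⊑'_ = Induced P _≈_
      Ex : State → Action → State → Set
      Ex p₀ a r = ∃[ p ] (p ~ p₀ × ∃[ x ] (p ⟶[ a ] x × x ≈ r))
      All : State → Action → (State → Set) → Set
      All p₀ a X = ∀ p → p ~ p₀ → ∃[ x ] (p ⟶[ a ] x × X x)

  IsSigma : (Action → Set) → PRPair → Partition → (State → Set) → PRPair → Set₁
  IsSigma B P P' S' R =
      (R ⊲ P)
    × Stable B R (SplitRel P' S')
    × (∀ Q → Q ⊲ P → Stable B Q (SplitRel P' S') → Q ⊲ R)

module Submission where

open import Defs
open import Data.Product using (_,_)

module _ (G : LTS) where
  open LTSDefs G

  ⊲-trans : (P Q R : PRPair) → P ⊲ Q → Q ⊲ R → P ⊲ R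
  ⊲-trans _ _ _ P⊲Q Q⊲R p q p⊑q with P⊲Q p q p⊑q
  ... | p' , q' , p⊆p' , q⊆q' , p'⊑q' with Q⊲R p' q' p'⊑q'
  ... | p'' , q'' , p'⊆p'' , q'⊆q'' , p''⊑q'' =
    p'' , q'' , (λ x x~p → p'⊆p'' x (p⊆p' x x~p)) , (λ x x~q → q'⊆q'' x (q⊆q' x x~q)) , p''⊑q''

-- σ(𝒫₁,⊑₁,…) is stable and lies below (𝒫₂,⊑₂), so the coarseness of σ(𝒫₂,⊑₂,…) applies to it.
theorem8 : (G : LTS) (B : LTS.Action G → Set) →
    let open LTSDefs G in
    (P₁ P₂ : PRPair) → P₁ ⊲ P₂ →
    (P' : Partition) → IsParent (Partition._~_ P') (PRPair._~_ P₂) →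
    (s₀ : LTS.State G) (S' : LTS.State G → Set) → IsSplitter P₂ P' s₀ S' →
    (R₁ R₂ : PRPair) → IsSigma B P₁ P' S' R₁ → IsSigma B P₂ P' S' R₂ →
    R₁ ⊲ R₂
theorem8 G B P₁ P₂ P₁⊲P₂ P' _ s₀ S' _ R₁ R₂ (R₁⊲P₁ , R₁-stable , _) (_ , _ , R₂-coarsest) =
  R₂-coarsest R₁ (⊲-trans G R₁ P₁ P₂ R₁⊲P₁ P₁⊲P₂) R₁-stable
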